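{- For every integer $n>0$ and every integer $j$ with $0\le j\le n$, the number $\Phi_n$ divides $\binom{n+j}n\binom{2n-j}n$.
   Context: $\Phi_n=\prod p$, the product over all primes $p$ such that the fractional part $\{n/p\}$ lies in $[2/3,1[$. -}

module Defs where

open import Data.Nat using (ℕ; zero; suc; _+_; _*_; _≤_; _≤?_)
open import Data.Nat.DivMod using (_%_)
open import Data.Nat.Primality using (Prime; prime?)
open import Data.List using (List; upTo; filter)
open import Data.Nat.ListAction using (product)
open import Data.Product using (_×_)
open import Relation.Nullary.Decidable using (Dec; _×-dec_)

-- {n/p} ∈ [2/3, 1[  ⇔  (n mod p) / p ≥ 2/3  ⇔  2p ≤ 3 (n mod p)   (for p ≥ 1).
-- The upper bound "< 1" holds automatically. p = 0 is never prime.
FracInRange : ℕ → ℕ → Set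
FracInRange n zero    = 2 * zero ≤ 3 * zero
FracInRange n (suc q) = 2 * suc q ≤ 3 * (n % suc q)

fracInRange? : (n p : ℕ) → Dec (FracInRange n p)
fracInRange? n zero    = 2 * zero ≤? 3 * zero
fracInRange? n (suc q) = 2 * suc q ≤? 3 * (n % suc q)

-- Any prime p with {n/p} ∈ [2/3,1[ satisfies p ≤ 3n/2 (if p > n then {n/p} = n/p),
-- so it suffices to range over p < 2n+1.
Φ : ℕ → ℕ
Φ n = product (filter (λ p → prime? p ×-dec fracInRange? n p) (upTo (suc (2 * n))))

{-# OPTIONS --safe #-}
-- Fix a prime p with {n/p} ≥ 2/3, i.e. 3r ≥ 2p for r = n mod p, and let x, y be the residues
-- of j and n − j. Since r ≡ x + y (mod p) we have r ≤ x + y, so r + x < p and r + y < p together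
-- would give 3r < 2p. Hence adding j, or n − j, to n carries in the last base-p digit, and a
-- carry makes p divide the binomial coefficient: p ∣ C(m, k) whenever m mod p < k mod p, by
-- induction on the residue of m using k·C(m, k) = m·C(m − 1, k − 1) and Euclid's lemma.
-- As Φ n is a product of distinct primes, each dividing the product, Φ n divides it too.
module Submission where

open import Defs
open import Data.Nat using (ℕ; zero; suc; _+_; _*_; _∸_; _≤_; _<_; s≤s; NonZero)
open import Data.Nat.Properties
open import Data.Nat.Combinatorics using (_C_; nC1≡n; nCk+nC[k+1]≡[n+1]C[k+1])
open import Data.Nat.Divisibility
  using (_∣_; divides; 1∣_; ∣⇒≤; ∣m+n∣m⇒∣n; n∣m*n; ∣m⇒∣m*n; ∣n⇒∣m*n; *-monoˡ-∣)
open import Data.Nat.DivMod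
  using (_%_; _/_; m≡m%n+[m/n]*n; m%n<n; m%n≤m; %-distribˡ-+; m≤n⇒[n∸m]%m≡n%m; m<n⇒m%n≡m)
open import Data.Nat.Primality using (Prime; prime?; euclidsLemma; prime⇒irreducible; prime⇒nonZero)
open import Data.Nat.Primality.Factorisation using (factorisationHasAllPrimeFactors)
open import Data.Nat.Coprimality using (Coprime; coprime-divisor)
open import Data.Nat.ListAction using (product)
open import Data.Nat.Tactic.RingSolver using (solve-∀)
open import Data.List using (upTo)
open import Data.List.Membership.Propositional using (_∉_)
open import Data.List.Membership.Propositional.Properties using (∈-filter⁻)
open import Data.List.Relation.Unary.All as All using (All; []; _∷_)
open import Data.List.Relation.Unary.All.Properties using (All¬⇒¬Any)
open import Data.List.Relation.Unary.AllPairs using ([]; _∷_)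
open import Data.List.Relation.Unary.Unique.Propositional using (Unique)
open import Data.List.Relation.Unary.Unique.Propositional.Properties using (filter⁺; upTo⁺)
open import Data.Product using (_×_; _,_; proj₁; proj₂)
open import Data.Sum using (_⊎_; inj₁; inj₂; fromInj₂)
open import Relation.Nullary using (¬_; yes; no; contradiction)
open import Relation.Nullary.Decidable using (_×-dec_)
open import Relation.Unary using (Decidable)
open import Relation.Binary.PropositionalEquality

[k+1]*[n+1]C[k+1]≡[n+1]*nCk : ∀ n k → suc k * (suc n C suc k) ≡ suc n * (n C k)
[k+1]*[n+1]C[k+1]≡[n+1]*nCk n zero = trans (+-identityʳ _) (trans (nC1≡n (suc n)) (sym (*-identityʳ _)))
[k+1]*[n+1]C[k+1]≡[n+1]*nCk zero (suc k) = *-zeroʳ (suc (suc k))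
[k+1]*[n+1]C[k+1]≡[n+1]*nCk (suc n) (suc k) = begin
  suc K * (suc N C suc K)
    ≡⟨ cong (suc K *_) (nCk+nC[k+1]≡[n+1]C[k+1] N K) ⟨
  suc K * (N C K + N C suc K)
    ≡⟨ *-distribˡ-+ (suc K) (N C K) (N C suc K) ⟩
  (N C K + K * (N C K)) + suc K * (N C suc K)
    ≡⟨ cong₂ (λ a b → (N C K + a) + b)
         ([k+1]*[n+1]C[k+1]≡[n+1]*nCk n k) ([k+1]*[n+1]C[k+1]≡[n+1]*nCk n K) ⟩
  (N C K + N * (n C k)) + N * (n C K)
    ≡⟨ +-assoc (N C K) _ _ ⟩
  N C K + (N * (n C k) + N * (n C K))
    ≡⟨ cong (N C K +_) (*-distribˡ-+ N (n C k) (n C K)) ⟨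
  N C K + N * (n C k + n C K)
    ≡⟨ cong (λ a → N C K + N * a) (nCk+nC[k+1]≡[n+1]C[k+1] n k) ⟩
  suc N * (N C K) ∎
  where
  open ≡-Reasoning
  N K : ℕ
  N = suc n
  K = suc k

[k+1]*nC[k+1]≡n*[n∸1]Ck : ∀ n k → suc k * (n C suc k) ≡ n * ((n ∸ 1) C k)
[k+1]*nC[k+1]≡n*[n∸1]Ck zero    k = *-zeroʳ (suc k)
[k+1]*nC[k+1]≡n*[n∸1]Ck (suc n) k = [k+1]*[n+1]C[k+1]≡[n+1]*nCk n k

[m+n]%d<m%d : ∀ {m n d} .{{_ : NonZero d}} → d ≤ m % d + n % d → (m + n) % d < m % d
[m+n]%d<m%d {m} {n} {d} carry = begin-strict
  (m + n) % d         ≡⟨ %-distribˡ-+ m n d ⟩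
  (x + y) % d         ≡⟨ m≤n⇒[n∸m]%m≡n%m carry ⟨
  (x + y ∸ d) % d     ≡⟨ m<n⇒m%n≡m (<-trans x+y∸d<x (m%n<n m d)) ⟩
  x + y ∸ d           <⟨ x+y∸d<x ⟩
  x                   ∎
  where
  open ≤-Reasoning
  x = m % d
  y = n % d
  x+y∸d<x : x + y ∸ d < x
  x+y∸d<x = subst (x + y ∸ d <_) (m+n∸n≡m x d) (∸-monoˡ-< (+-monoʳ-< x (m%n<n n d)) carry)

2p≤3r⇒p≤r+x⊎p≤r+y : ∀ {p r x y} → r ≤ x + y → 2 * p ≤ 3 * r → p ≤ r + x ⊎ p ≤ r + y
2p≤3r⇒p≤r+x⊎p≤r+y {p} {r} {x} {y} r≤x+y 2p≤3r with p ≤? r + x | p ≤? r + y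
... | yes p≤r+x | _         = inj₁ p≤r+x
... | no _      | yes p≤r+y = inj₂ p≤r+y
... | no p≰r+x  | no p≰r+y  = contradiction 2p≤3r (<⇒≱ 3r<2p)
  where
  3r<2p : 3 * r < 2 * p
  3r<2p = begin-strict
    3 * r             ≡⟨ 3r≡2r+r r ⟩
    2 * r + r         ≤⟨ +-monoʳ-≤ (2 * r) r≤x+y ⟩
    2 * r + (x + y)   ≡⟨ 2r+[x+y]≡[r+x]+[r+y] r x y ⟩
    (r + x) + (r + y) <⟨ +-mono-< (≰⇒> p≰r+x) (≰⇒> p≰r+y) ⟩
    p + p             ≡⟨ p+p≡2p p ⟩
    2 * p             ∎
    where
    open ≤-Reasoning
    3r≡2r+r : ∀ r → 3 * r ≡ 2 * r + r
    3r≡2r+r = solve-∀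
    2r+[x+y]≡[r+x]+[r+y] : ∀ r x y → 2 * r + (x + y) ≡ (r + x) + (r + y)
    2r+[x+y]≡[r+x]+[r+y] = solve-∀
    p+p≡2p : ∀ p → p + p ≡ 2 * p
    p+p≡2p = solve-∀

coprime∧∣∧∣⇒*∣ : ∀ {m n o} → Coprime m n → m ∣ o → n ∣ o → m * n ∣ o
coprime∧∣∧∣⇒*∣ {m} {n} coprime m∣o (divides q refl) =
  *-monoˡ-∣ n (coprime-divisor coprime (subst (m ∣_) (*-comm q n) m∣o))

prime∉⇒coprime-product : ∀ {p ps} → Prime p → All Prime ps → p ∉ ps → Coprime p (product ps)
prime∉⇒coprime-product p-prime ps-prime p∉ps (d∣p , d∣Πps) with prime⇒irreducible p-prime d∣p
... | inj₁ d≡1 = d≡1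
... | inj₂ refl = contradiction (factorisationHasAllPrimeFactors p-prime d∣Πps ps-prime) p∉ps

product-∣ : ∀ {ps m} → Unique ps → All (λ p → Prime p × p ∣ m) ps → product ps ∣ m
product-∣ []                 []                           = 1∣ _
product-∣ (p∉ps ∷ ps-unique) ((p-prime , p∣m) ∷ ps-prime) =
  coprime∧∣∧∣⇒*∣
    (prime∉⇒coprime-product p-prime (All.map proj₁ ps-prime) (All¬⇒¬Any p∉ps))
    p∣m
    (product-∣ ps-unique ps-prime)

module _ {p} (p-prime : Prime p) where

  private instance
    p-nonZero : NonZero p
    p-nonZero = prime⇒nonZero p-prime

  ∤[1+s]+d*p : ∀ {s} d → suc s < p → ¬ p ∣ suc s + d * p
  ∤[1+s]+d*p {s} d s<p p∣1+s+dp = <⇒≱ s<p (∣⇒≤ p∣1+s)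
    where
    p∣1+s : p ∣ suc s
    p∣1+s = ∣m+n∣m⇒∣n (subst (p ∣_) (+-comm (suc s) (d * p)) p∣1+s+dp) (n∣m*n d)

  ∣C[1+k] : ∀ {n k} → ¬ p ∣ suc k → p ∣ n * ((n ∸ 1) C k) → p ∣ n C suc k
  ∣C[1+k] {n} {k} p∤k+1 p∣rhs =
    fromInj₂ (λ p∣k+1 → contradiction p∣k+1 p∤k+1)
      (euclidsLemma (suc k) (n C suc k) p-prime
        (subst (p ∣_) (sym ([k+1]*nC[k+1]≡n*[n∸1]Ck n k)) p∣rhs))

  ∣[r+c*p]C[s+d*p] : ∀ c d {r s} → r < s → s < p → p ∣ (r + c * p) C (s + d * p)
  ∣[r+c*p]C[s+d*p] c d {zero} {suc s} _ s<p =
    ∣C[1+k] {n = c * p} (∤[1+s]+d*p d s<p) (∣m⇒∣m*n _ (n∣m*n c))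
  ∣[r+c*p]C[s+d*p] c d {suc r} {suc s} (s≤s r<s) s<p =
    ∣C[1+k] (∤[1+s]+d*p d s<p)
      (∣n⇒∣m*n (suc (r + c * p)) (∣[r+c*p]C[s+d*p] c d r<s (<-trans (n<1+n s) s<p)))

  m%p<k%p⇒∣mCk : ∀ {m k} → m % p < k % p → p ∣ m C k
  m%p<k%p⇒∣mCk {m} {k} lt =
    subst₂ (λ a b → p ∣ a C b) (sym (m≡m%n+[m/n]*n m p)) (sym (m≡m%n+[m/n]*n k p))
      (∣[r+c*p]C[s+d*p] (m / p) (k / p) lt (m%n<n k p))

  carry⇒∣[m+n]Cm : ∀ {m n} → p ≤ m % p + n % p → p ∣ (m + n) C m
  carry⇒∣[m+n]Cm carry = m%p<k%p⇒∣mCk ([m+n]%d<m%d carry)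

  ∣[n+j]Cn*[2n∸j]Cn : ∀ {n j} → j ≤ n → 2 * p ≤ 3 * (n % p) → p ∣ ((n + j) C n) * ((2 * n ∸ j) C n)
  ∣[n+j]Cn*[2n∸j]Cn {n} {j} j≤n frac with 2p≤3r⇒p≤r+x⊎p≤r+y r≤x+y frac
    where
    r≤x+y : n % p ≤ j % p + (n ∸ j) % p
    r≤x+y = begin
      n % p                       ≡⟨ cong (_% p) (m+[n∸m]≡n j≤n) ⟨
      (j + (n ∸ j)) % p           ≡⟨ %-distribˡ-+ j (n ∸ j) p ⟩
      (j % p + (n ∸ j) % p) % p   ≤⟨ m%n≤m _ p ⟩
      j % p + (n ∸ j) % p         ∎
      where open ≤-Reasoning
  ... | inj₁ carry = ∣m⇒∣m*n ((2 * n ∸ j) C n) (carry⇒∣[m+n]Cm carry)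
  ... | inj₂ carry =
    ∣n⇒∣m*n ((n + j) C n) (subst (λ m → p ∣ m C n) (sym 2n∸j≡n+[n∸j]) (carry⇒∣[m+n]Cm carry))
    where
    2n∸j≡n+[n∸j] : 2 * n ∸ j ≡ n + (n ∸ j)
    2n∸j≡n+[n∸j] = trans (cong (λ m → n + m ∸ j) (+-identityʳ n)) (+-∸-assoc n j≤n)

mainTheorem15 : ∀ (n j : ℕ) → 0 < n → j ≤ n →
    Φ n ∣ ((n + j) C n) * ((2 * n ∸ j) C n)
mainTheorem15 n j _ j≤n =
  product-∣ (filter⁺ P? (upTo⁺ (suc (2 * n))))
    (All.tabulate (λ p∈ → prime∧∣ (proj₂ (∈-filter⁻ P? {xs = upTo (suc (2 * n))} p∈))))
  where
  P? : Decidable (λ p → Prime p × FracInRange n p)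
  P? p = prime? p ×-dec fracInRange? n p
  prime∧∣ : ∀ {p} → Prime p × FracInRange n p → Prime p × p ∣ ((n + j) C n) * ((2 * n ∸ j) C n)
  prime∧∣ {suc _} (p-prime , frac) = p-prime , ∣[n+j]Cn*[2n∸j]Cn p-prime j≤n frac
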